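{- Let $G$ be a connected graph with at least one edge. The maximum order of a tight bramble of $G$ is $1$ if and only if $G$ is a tree.
   Context: Graphs are finite and simple. Two sets $S_1,S_2\subseteq V(G)$ are touching if $S_1\cap S_2\ne\emptyset$ or there are two distinct edges $x_1x_2,y_1y_2\in E(G)$ with $x_1,y_1\in S_1$, $x_2,y_2\in S_2$. A tight bramble of $G$ is a set $\mathcal B$ of pairwise touching subsets of $V(G)$, each inducing a connected subgraph and of size at least two. A cover of $\mathcal B$ is a set of vertices meeting every element of $\mathcal B$; the order of $\mathcal B$ is the minimum size of a cover. -}

module Defs where

open import Data.Nat using (ℕ; _≤_; _≥_)
open import Data.Fin using (Fin)
open import Data.Fin.Subset using (Subset; _∈_; _∩_; ∣_∣; Nonempty; ⊤)
open import Data.List using (List; _∷_; []; length; head; last)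
open import Data.List.Membership.Propositional renaming (_∈_ to _∈ₗ_)
open import Data.List.Relation.Unary.All using (All)
open import Data.List.Relation.Unary.Unique.Propositional using (Unique)
open import Data.List.Relation.Unary.Linked using (Linked)
open import Data.Maybe using (Maybe; just)
open import Data.Product using (Σ; ∃; _×_; _,_; ∃-syntax)
open import Data.Empty using (⊥)
open import Data.Sum using (_⊎_)
open import Relation.Nullary using (¬_)
open import Relation.Binary.PropositionalEquality using (_≡_)

record Graph (n : ℕ) : Set₁ where
  field
    Adj     : Fin n → Fin n → Set
    sym     : ∀ {x y} → Adj x y → Adj y x
    irrefl  : ∀ {x} → ¬ Adj x x

module _ {n : ℕ} (G : Graph n) where
  open Graph G

  HasEdge : Set
  HasEdge = ∃[ x ] ∃[ y ] Adj x y

  data ReachIn (S : Subset n) : Fin n → Fin n → Set where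
    here : ∀ {u} → u ∈ S → ReachIn S u u
    step : ∀ {u w v} → u ∈ S → Adj u w → ReachIn S w v → ReachIn S u v

  InducesConnected : Subset n → Set
  InducesConnected S = ∀ u v → u ∈ S → v ∈ S → ReachIn S u v

  Connected : Set
  Connected = InducesConnected ⊤

  IsCycle : List (Fin n) → Set
  IsCycle vs = 3 ≤ length vs × Unique vs × Linked Adj vs
             × ∃[ a ] ∃[ b ] (head vs ≡ just a × last vs ≡ just b × Adj b a)

  Acyclic : Set
  Acyclic = ∀ vs → ¬ IsCycle vs

  IsTree : Set
  IsTree = Connected × Acyclic

  DistinctEdges : Fin n → Fin n → Fin n → Fin n → Set
  DistinctEdges x₁ x₂ y₁ y₂ =
    ¬ (x₁ ≡ y₁ × x₂ ≡ y₂) × ¬ (x₁ ≡ y₂ × x₂ ≡ y₁)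

  Touching : Subset n → Subset n → Set
  Touching S₁ S₂ =
    Nonempty (S₁ ∩ S₂)
    ⊎ (∃[ x₁ ] ∃[ x₂ ] ∃[ y₁ ] ∃[ y₂ ]
          (Adj x₁ x₂ × Adj y₁ y₂ × DistinctEdges x₁ x₂ y₁ y₂
           × x₁ ∈ S₁ × y₁ ∈ S₁ × x₂ ∈ S₂ × y₂ ∈ S₂))

  IsTightBramble : List (Subset n) → Set
  IsTightBramble ℬ =
    (∀ {S₁ S₂} → S₁ ∈ₗ ℬ → S₂ ∈ₗ ℬ → Touching S₁ S₂)
    × All (λ S → InducesConnected S × 2 ≤ ∣ S ∣) ℬ

IsCover : {n : ℕ} → List (Subset n) → Subset n → Set
IsCover ℬ C = All (λ S → Nonempty (C ∩ S)) ℬ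

HasOrder : {n : ℕ} → List (Subset n) → ℕ → Set
HasOrder ℬ k = (∃[ C ] (IsCover ℬ C × ∣ C ∣ ≡ k))
             × (∀ C → IsCover ℬ C → k ≤ ∣ C ∣)

MaxTightBrambleOrder : {n : ℕ} → Graph n → ℕ → Set
MaxTightBrambleOrder G k =
  (∃[ ℬ ] (IsTightBramble G ℬ × HasOrder ℬ k))
  × (∀ ℬ j → IsTightBramble G ℬ → HasOrder ℬ j → j ≤ k)

-- In a forest every edge is a bridge. Hence two touching connected sets
-- intersect (otherwise the two edges between them close a cycle), the
-- intersection of two connected sets is connected, and three pairwise
-- intersecting connected sets share a vertex. By induction all members of a
-- tight bramble share a vertex, which is a cover of size 1, and a single edge
-- is a tight bramble of order 1. Conversely a cycle v₁ v₂ … v_k yields the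
-- tight bramble {v₁v₂, {v₂, …, v_k}, v_kv₁}, whose members pairwise
-- intersect but have no common vertex, so it has order 2.
module Submission where

open import Defs
open import Data.Nat using (ℕ; _≤_; _<_; z≤n; s≤s)
open import Data.Nat.Properties using (≤-trans; ≤-reflexive; <-≤-trans)
open import Data.Fin using (Fin; zero; suc)
open import Data.Fin.Properties using (_≟_)
open import Data.Fin.Subset using (Subset; _∈_; _∉_; _⊆_; _∩_; _∪_; ∣_∣; Nonempty; ⊥; ⁅_⁆)
open import Data.Fin.Subset.Properties
  using ( x∈p∩q⁺; x∈p∩q⁻; x∈p∪q⁺; x∈p∪q⁻; q⊆p∪q; ∪-identityˡ; ∪-identityʳ; ∩-comm
        ; x∈⁅x⁆; x∈⁅y⁆⇒x≡y; ∣⁅x⁆∣≡1; ∣⊥∣≡0; ∉⊥; nonempty?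
        ; x∈p∧x≢y⇒x∈p-y; x∈p⇒∣p-x∣<∣p∣ )
  renaming (_∈?_ to _∈ˢ?_)
open import Data.List using (List; []; _∷_; last)
open import Data.List.Membership.Propositional using (find) renaming (_∈_ to _∈ₗ_; _∉_ to _∉ₗ_)
import Data.List.Membership.DecPropositional as DecMembership
open import Data.List.Relation.Unary.Any using (here; there)
open import Data.List.Relation.Unary.All as All using (All; []; _∷_)
open import Data.List.Relation.Unary.All.Properties using (¬Any⇒All¬; All¬⇒¬Any; ¬All⇒Any¬)
open import Data.List.Relation.Unary.Unique.Propositional using (Unique)
open import Data.List.Relation.Unary.AllPairs using ([]; _∷_)
open import Data.List.Relation.Unary.Linked using (Linked; [-]; _∷_)
open import Data.Maybe using (just)
open import Data.Product using (∃; _×_; _,_; proj₁; proj₂; ∃-syntax)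
open import Data.Sum using (_⊎_; inj₁; inj₂)
import Data.Sum as Sum
open import Data.Empty using (⊥-elim)
open import Relation.Nullary using (¬_; yes; no)
open import Relation.Binary.PropositionalEquality using (_≡_; _≢_; refl; sym; cong; subst)
open import Relation.Binary.Construct.Closure.ReflexiveTransitive as Star
  using (Star; ε; _◅_; _◅◅_)
open import Function.Bundles using (_⇔_; mk⇔)

private
  variable
    n : ℕ
    j : ℕ
    a b u v w x y z : Fin n
    A B C S T : Subset n
    ℬ : List (Subset n)

x∈p⇒0<∣p∣ : x ∈ S → 0 < ∣ S ∣
x∈p⇒0<∣p∣ x∈S = <-≤-trans (s≤s z≤n) (x∈p⇒∣p-x∣<∣p∣ x∈S)

x∈p∧y∈p∧x≢y⇒1<∣p∣ : x ∈ S → y ∈ S → x ≢ y → 1 < ∣ S ∣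
x∈p∧y∈p∧x≢y⇒1<∣p∣ x∈S y∈S x≢y =
  <-≤-trans (s≤s (x∈p⇒0<∣p∣ (x∈p∧x≢y⇒x∈p-y y∈S (λ y≡x → x≢y (sym y≡x)))))
            (x∈p⇒∣p-x∣<∣p∣ x∈S)

∣⁅x⁆∪⁅y⁆∣≡2 : x ≢ y → ∣ ⁅ x ⁆ ∪ ⁅ y ⁆ ∣ ≡ 2
∣⁅x⁆∪⁅y⁆∣≡2 {x = zero}  {y = zero}  x≢y = ⊥-elim (x≢y refl)
∣⁅x⁆∪⁅y⁆∣≡2 {x = zero}  {y = suc y} _ rewrite ∪-identityˡ ⁅ y ⁆ | ∣⁅x⁆∣≡1 y = refl
∣⁅x⁆∪⁅y⁆∣≡2 {x = suc x} {y = zero}  _ rewrite ∪-identityʳ ⁅ x ⁆ | ∣⁅x⁆∣≡1 x = refl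
∣⁅x⁆∪⁅y⁆∣≡2 {x = suc x} {y = suc y} x≢y = ∣⁅x⁆∪⁅y⁆∣≡2 (λ x≡y → x≢y (cong suc x≡y))

x∈⁅x⁆∪⁅y⁆ : (x y : Fin n) → x ∈ ⁅ x ⁆ ∪ ⁅ y ⁆
x∈⁅x⁆∪⁅y⁆ x y = x∈p∪q⁺ (inj₁ (x∈⁅x⁆ x))

y∈⁅x⁆∪⁅y⁆ : (x y : Fin n) → y ∈ ⁅ x ⁆ ∪ ⁅ y ⁆
y∈⁅x⁆∪⁅y⁆ x y = x∈p∪q⁺ (inj₂ (x∈⁅x⁆ y))

∈⁅x⁆∪⁅y⁆⇒≡⊎≡ : u ∈ ⁅ x ⁆ ∪ ⁅ y ⁆ → u ≡ x ⊎ u ≡ y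
∈⁅x⁆∪⁅y⁆⇒≡⊎≡ {x = x} {y = y} u∈ =
  Sum.map (x∈⁅y⁆⇒x≡y x) (x∈⁅y⁆⇒x≡y y) (x∈p∪q⁻ ⁅ x ⁆ ⁅ y ⁆ u∈)

∈⇒∩-nonempty : x ∈ S → x ∈ T → Nonempty (S ∩ T)
∈⇒∩-nonempty x∈S x∈T = _ , x∈p∩q⁺ (x∈S , x∈T)

fromList : List (Fin n) → Subset n
fromList []       = ⊥
fromList (x ∷ xs) = ⁅ x ⁆ ∪ fromList xs

∈fromList⁺ : {xs : List (Fin n)} → u ∈ₗ xs → u ∈ fromList xs
∈fromList⁺ (here refl)  = x∈p∪q⁺ (inj₁ (x∈⁅x⁆ _))
∈fromList⁺ (there u∈xs) = x∈p∪q⁺ (inj₂ (∈fromList⁺ u∈xs))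

∈fromList⁻ : (xs : List (Fin n)) → u ∈ fromList xs → u ∈ₗ xs
∈fromList⁻ []       u∈ = ⊥-elim (∉⊥ u∈)
∈fromList⁻ (x ∷ xs) u∈ with x∈p∪q⁻ ⁅ x ⁆ (fromList xs) u∈
... | inj₁ u∈⁅x⁆ = here (x∈⁅y⁆⇒x≡y x u∈⁅x⁆)
... | inj₂ u∈xs  = there (∈fromList⁻ xs u∈xs)

last≡just⇒∈ : {X : Set} {x : X} (xs : List X) → last xs ≡ just x → x ∈ₗ xs
last≡just⇒∈ (y ∷ [])     refl = here refl
last≡just⇒∈ (y ∷ z ∷ xs) eq   = there (last≡just⇒∈ (z ∷ xs) eq)

PairwiseIntersecting : List (Subset n) → Set
PairwiseIntersecting ℬ = ∀ {S₁ S₂} → S₁ ∈ₗ ℬ → S₂ ∈ₗ ℬ → Nonempty (S₁ ∩ S₂)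

triangle⇒pairwiseIntersecting : x ∈ A → x ∈ B → y ∈ B → y ∈ C → z ∈ C → z ∈ A →
                                 PairwiseIntersecting (A ∷ B ∷ C ∷ [])
triangle⇒pairwiseIntersecting x∈A x∈B y∈B y∈C z∈C z∈A = meet
  where
  meet : PairwiseIntersecting _
  meet (here refl)                 (here refl)                 = ∈⇒∩-nonempty x∈A x∈A
  meet (here refl)                 (there (here refl))         = ∈⇒∩-nonempty x∈A x∈B
  meet (here refl)                 (there (there (here refl))) = ∈⇒∩-nonempty z∈A z∈C
  meet (there (here refl))         (here refl)                 = ∈⇒∩-nonempty x∈B x∈A
  meet (there (here refl))         (there (here refl))         = ∈⇒∩-nonempty y∈B y∈B
  meet (there (here refl))         (there (there (here refl))) = ∈⇒∩-nonempty y∈B y∈C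
  meet (there (there (here refl))) (here refl)                 = ∈⇒∩-nonempty z∈C z∈A
  meet (there (there (here refl))) (there (here refl))         = ∈⇒∩-nonempty y∈C y∈B
  meet (there (there (here refl))) (there (there (here refl))) = ∈⇒∩-nonempty z∈C z∈C

commonVertex⇒order≤1 : All (v ∈_) ℬ → HasOrder ℬ j → j ≤ 1
commonVertex⇒order≤1 {v = v} v∈ℬ (_ , minimal) =
  ≤-trans (minimal ⁅ v ⁆ (All.map (∈⇒∩-nonempty (x∈⁅x⁆ v)) v∈ℬ)) (≤-reflexive (∣⁅x⁆∣≡1 v))

noCommonVertex⇒1<∣cover∣ : ¬ (∃[ v ] All (v ∈_) (S ∷ ℬ)) → IsCover (S ∷ ℬ) C → 1 < ∣ C ∣
noCommonVertex⇒1<∣cover∣ {S = S} {ℬ = ℬ} {C = C} noCommon cover@((u , u∈C∩S) ∷ _)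
  with find (¬All⇒Any¬ (u ∈ˢ?_) (S ∷ ℬ) (λ u∈ℬ → noCommon (u , u∈ℬ)))
... | T , T∈ℬ , u∉T with All.lookup cover T∈ℬ
...   | w , w∈C∩T = x∈p∧y∈p∧x≢y⇒1<∣p∣ u∈C w∈C (λ { refl → u∉T w∈T })
  where
  u∈C = proj₁ (x∈p∩q⁻ C S u∈C∩S)
  w∈C = proj₁ (x∈p∩q⁻ C T w∈C∩T)
  w∈T = proj₂ (x∈p∩q⁻ C T w∈C∩T)

module _ {R : Fin n → Fin n → Set} where

  -- Defined through successors so that the head of vertices p is u by definition.
  vertices : Star R u v → List (Fin n)

  successors : Star R u v → List (Fin n)
  successors ε       = []
  successors (_ ◅ p) = vertices p

  vertices {u = u} p = u ∷ successors p

  vertices-linked : {R′ : Fin n → Fin n → Set} → (∀ {x y} → R x y → R′ x y) →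
                    (p : Star R u v) → Linked R′ (vertices p)
  vertices-linked f ε       = [-]
  vertices-linked f (e ◅ p) = f e ∷ vertices-linked f p

  last-vertices : (p : Star R u v) → last (vertices p) ≡ just v
  last-vertices ε       = refl
  last-vertices (_ ◅ p) = last-vertices p

  Path : Fin n → Fin n → Set
  Path u v = ∃ λ (p : Star R u v) → Unique (vertices p)

  dropUntil : (p : Star R w v) → u ∈ₗ vertices p → Unique (vertices p) → Path u v
  dropUntil p       (here refl) uniq       = p , uniq
  dropUntil (_ ◅ p) (there u∈p) (_ ∷ uniq) = dropUntil p u∈p uniq

  open DecMembership (_≟_ {n}) using (_∈?_)

  walk⇒path : Star R u v → Path u v
  walk⇒path ε = ε , [] ∷ []
  walk⇒path {u = u} (e ◅ p) with walk⇒path p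
  ... | q , uniq with u ∈? vertices q
  ...   | yes u∈q = dropUntil q u∈q uniq
  ...   | no  u∉q = e ◅ q , ¬Any⇒All¬ (vertices q) u∉q ∷ uniq

module _ (G : Graph n) where
  open Graph G renaming (sym to Adj-sym)

  AdjIn : Subset n → Fin n → Fin n → Set
  AdjIn S x y = Adj x y × x ∈ S × y ∈ S

  AdjExcept : Fin n → Fin n → Fin n → Fin n → Set
  AdjExcept a b x y = Adj x y × DistinctEdges G x y a b

  Adj⇒≢ : Adj x y → x ≢ y
  Adj⇒≢ xy refl = irrefl xy

  reachIn-head : ReachIn G S u v → u ∈ S
  reachIn-head (here u∈S)     = u∈S
  reachIn-head (step u∈S _ _) = u∈S

  reachIn-trans : ReachIn G S u w → ReachIn G S w v → ReachIn G S u v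
  reachIn-trans (here _)         r′ = r′
  reachIn-trans (step u∈S uw r) r′ = step u∈S uw (reachIn-trans r r′)

  reachIn-sym : ReachIn G S u v → ReachIn G S v u
  reachIn-sym (here u∈S)      = here u∈S
  reachIn-sym (step u∈S uw r) =
    reachIn-trans (reachIn-sym r) (step (reachIn-head r) (Adj-sym uw) (here u∈S))

  reachIn-mono : S ⊆ T → ReachIn G S u v → ReachIn G T u v
  reachIn-mono S⊆T (here u∈S)      = here (S⊆T u∈S)
  reachIn-mono S⊆T (step u∈S uw r) = step (S⊆T u∈S) uw (reachIn-mono S⊆T r)

  reachIn⇒walk : ReachIn G S u v → Star (AdjIn S) u v
  reachIn⇒walk (here _)         = ε
  reachIn⇒walk (step u∈S uw r) = (uw , u∈S , reachIn-head r) ◅ reachIn⇒walk r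

  edgeIn⇒distinct : a ∉ S ⊎ b ∉ S → x ∈ S → y ∈ S → DistinctEdges G x y a b
  edgeIn⇒distinct (inj₁ a∉S) x∈S y∈S =
    (λ { (refl , _) → a∉S x∈S }) , (λ { (_ , refl) → a∉S y∈S })
  edgeIn⇒distinct (inj₂ b∉S) x∈S y∈S =
    (λ { (_ , refl) → b∉S y∈S }) , (λ { (refl , _) → b∉S x∈S })

  reachIn⇒walkExcept : a ∉ S ⊎ b ∉ S → ReachIn G S u v → Star (AdjExcept a b) u v
  reachIn⇒walkExcept outside r =
    Star.map (λ (xy , x∈S , y∈S) → xy , edgeIn⇒distinct outside x∈S y∈S) (reachIn⇒walk r)

  walkAvoiding⇒walkExcept : (p : Star (AdjIn S) u v) → a ∉ₗ vertices p → Star (AdjExcept a b) u v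
  walkAvoiding⇒walkExcept ε       _   = ε
  walkAvoiding⇒walkExcept (e ◅ p) a∉p =
    (proj₁ e , (λ { (refl , _) → a∉p (here refl) }) , (λ { (_ , refl) → a∉p (there (here refl)) }))
    ◅ walkAvoiding⇒walkExcept p (λ a∈p → a∉p (there a∈p))

  rooted⇒connected : (∀ {u} → u ∈ S → ReachIn G S v u) → InducesConnected G S
  rooted⇒connected reach u w u∈S w∈S = reachIn-trans (reachIn-sym (reach u∈S)) (reach w∈S)

  edge-connected : Adj x y → InducesConnected G (⁅ x ⁆ ∪ ⁅ y ⁆)
  edge-connected {x = x} {y = y} xy = rooted⇒connected reach
    where
    reach : u ∈ ⁅ x ⁆ ∪ ⁅ y ⁆ → ReachIn G (⁅ x ⁆ ∪ ⁅ y ⁆) x u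
    reach u∈ with ∈⁅x⁆∪⁅y⁆⇒≡⊎≡ u∈
    ... | inj₁ refl = here u∈
    ... | inj₂ refl = step (x∈⁅x⁆∪⁅y⁆ x y) xy (here u∈)

  edge-size : Adj x y → ∣ ⁅ x ⁆ ∪ ⁅ y ⁆ ∣ ≡ 2
  edge-size xy = ∣⁅x⁆∪⁅y⁆∣≡2 (Adj⇒≢ xy)

  linked⇒reachIn-fromList : {zs : List (Fin n)} → Linked Adj (z ∷ zs) → u ∈ₗ z ∷ zs →
                            ReachIn G (fromList (z ∷ zs)) z u
  linked⇒reachIn-fromList {zs = zs} _ (here refl) = here (∈fromList⁺ {xs = _ ∷ zs} (here refl))
  linked⇒reachIn-fromList {z = z} {zs = zs} (zw ∷ linked) (there u∈zs) =
    step (∈fromList⁺ {xs = z ∷ zs} (here refl)) zw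
         (reachIn-mono (q⊆p∪q ⁅ z ⁆ _) (linked⇒reachIn-fromList linked u∈zs))

  linked⇒fromList-connected : {zs : List (Fin n)} → Linked Adj (z ∷ zs) →
                              InducesConnected G (fromList (z ∷ zs))
  linked⇒fromList-connected linked =
    rooted⇒connected (λ u∈ → linked⇒reachIn-fromList linked (∈fromList⁻ _ u∈))

  module _ (acyclic : Acyclic G) where

    edge-is-bridge : Adj a b → ¬ Star (AdjExcept a b) b a
    edge-is-bridge {a = a} {b = b} ab detour with walk⇒path detour
    ... | ε , _                   = irrefl ab
    ... | (_ , _ , ba≢ab) ◅ ε , _ = ba≢ab (refl , refl)
    ... | p@(_ ◅ _ ◅ _) , uniq    = acyclic (vertices p)
      (s≤s (s≤s (s≤s z≤n)) , uniq , vertices-linked proj₁ p , b , a , refl , last-vertices p , ab)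

    -- Leaving T along uw is impossible: the rest of the path avoids u, a walk back
    -- inside T avoids w, and together they form a detour around uw.
    path-stays-in : InducesConnected G T → (p : Star (AdjIn S) u v) → Unique (vertices p) →
                    u ∈ S → u ∈ T → v ∈ T → ReachIn G (S ∩ T) u v
    path-stays-in _ ε _ u∈S u∈T _ = here (x∈p∩q⁺ (u∈S , u∈T))
    path-stays-in {T = T} T-conn (_◅_ {j = w} (uw , _ , w∈S) p) (u∉p ∷ uniq) u∈S u∈T v∈T
      with w ∈ˢ? T
    ... | yes w∈T = step (x∈p∩q⁺ (u∈S , u∈T)) uw (path-stays-in T-conn p uniq w∈S w∈T v∈T)
    ... | no  w∉T = ⊥-elim (edge-is-bridge uw
          (walkAvoiding⇒walkExcept p (All¬⇒¬Any u∉p)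
           ◅◅ reachIn⇒walkExcept (inj₂ w∉T) (T-conn _ _ v∈T u∈T)))

    ∩-connected : InducesConnected G S → InducesConnected G T → InducesConnected G (S ∩ T)
    ∩-connected {S = S} {T = T} S-conn T-conn u v u∈S∩T v∈S∩T
      with x∈p∩q⁻ S T u∈S∩T | x∈p∩q⁻ S T v∈S∩T
    ... | u∈S , u∈T | v∈S , v∈T with walk⇒path (reachIn⇒walk (S-conn u v u∈S v∈S))
    ...   | p , uniq = path-stays-in T-conn p uniq u∈S u∈T v∈T

    -- Follow the path inside A until it meets C; leaving A first along uw would give
    -- the detour: rest of the path, then through C to c, then through A back to u.
    path-meets : InducesConnected G A → InducesConnected G C → Nonempty (C ∩ A) →
                 (p : Star (AdjIn B) u v) → Unique (vertices p) →
                 u ∈ A → u ∈ B → v ∈ C → Nonempty ((A ∩ B) ∩ C)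
    path-meets _ _ _ ε _ u∈A u∈B u∈C = ∈⇒∩-nonempty (x∈p∩q⁺ (u∈A , u∈B)) u∈C
    path-meets {A = A} {C = C} A-conn C-conn (c , c∈C∩A)
      (_◅_ {i = u} {j = w} (uw , _ , w∈B) p) (u∉p ∷ uniq) u∈A u∈B v∈C
      with u ∈ˢ? C
    ... | yes u∈C = ∈⇒∩-nonempty (x∈p∩q⁺ (u∈A , u∈B)) u∈C
    ... | no  u∉C with w ∈ˢ? A
    ...   | yes w∈A = path-meets A-conn C-conn (c , c∈C∩A) p uniq w∈A w∈B v∈C
    ...   | no  w∉A = ⊥-elim (edge-is-bridge uw
            (walkAvoiding⇒walkExcept p (All¬⇒¬Any u∉p)
             ◅◅ reachIn⇒walkExcept (inj₁ u∉C) (C-conn _ c v∈C (proj₁ (x∈p∩q⁻ C A c∈C∩A)))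
             ◅◅ reachIn⇒walkExcept (inj₂ w∉A) (A-conn c u (proj₂ (x∈p∩q⁻ C A c∈C∩A)) u∈A)))

    helly₃ : InducesConnected G A → InducesConnected G B → InducesConnected G C →
             Nonempty (A ∩ B) → Nonempty (B ∩ C) → Nonempty (C ∩ A) → Nonempty ((A ∩ B) ∩ C)
    helly₃ {A = A} {B = B} {C = C} A-conn B-conn C-conn (x , x∈A∩B) (y , y∈B∩C) C∩A≢∅
      with x∈p∩q⁻ A B x∈A∩B | x∈p∩q⁻ B C y∈B∩C
    ... | x∈A , x∈B | y∈B , y∈C with walk⇒path (reachIn⇒walk (B-conn x y x∈B y∈B))
    ...   | p , uniq = path-meets A-conn C-conn C∩A≢∅ p uniq x∈A x∈B y∈C

    touching⇒intersecting : InducesConnected G S → InducesConnected G T → Touching G S T →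
                            Nonempty (S ∩ T)
    touching⇒intersecting _ _ (inj₁ S∩T≢∅) = S∩T≢∅
    touching⇒intersecting {S = S} {T = T} S-conn T-conn
      (inj₂ (x₁ , x₂ , y₁ , y₂ , x₁x₂ , y₁y₂ , (d₁ , d₂) , x₁∈S , y₁∈S , x₂∈T , y₂∈T))
      with nonempty? (S ∩ T)
    ... | yes S∩T≢∅ = S∩T≢∅
    ... | no  S∩T≡∅ = ⊥-elim (edge-is-bridge x₁x₂
          (reachIn⇒walkExcept (inj₁ x₁∉T) (T-conn x₂ y₂ x₂∈T y₂∈T)
           ◅◅ y₂y₁
           ◅ reachIn⇒walkExcept (inj₂ x₂∉S) (S-conn y₁ x₁ y₁∈S x₁∈S)))
      where
      x₁∉T : x₁ ∉ T
      x₁∉T x₁∈T = S∩T≡∅ (∈⇒∩-nonempty x₁∈S x₁∈T)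
      x₂∉S : x₂ ∉ S
      x₂∉S x₂∈S = S∩T≡∅ (∈⇒∩-nonempty x₂∈S x₂∈T)
      y₂y₁ : AdjExcept x₁ x₂ y₂ y₁
      y₂y₁ = Adj-sym y₁y₂
           , (λ { (refl , refl) → d₂ (refl , refl) })
           , (λ { (refl , refl) → d₁ (refl , refl) })

    pairwiseIntersecting-∩ : All (InducesConnected G) (S ∷ T ∷ ℬ) →
                             PairwiseIntersecting (S ∷ T ∷ ℬ) → PairwiseIntersecting (S ∩ T ∷ ℬ)
    pairwiseIntersecting-∩ {S = S} {T = T} {ℬ = ℬ} (S-conn ∷ T-conn ∷ ℬ-conn) meet = meet′
      where
      meets-∩ : {B : Subset _} → B ∈ₗ ℬ → Nonempty ((S ∩ T) ∩ B)
      meets-∩ B∈ℬ = helly₃ S-conn T-conn (All.lookup ℬ-conn B∈ℬ)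
        (meet (here refl) (there (here refl)))
        (meet (there (here refl)) (there (there B∈ℬ)))
        (meet (there (there B∈ℬ)) (here refl))
      meet′ : PairwiseIntersecting (S ∩ T ∷ ℬ)
      meet′ (here refl) (here refl) with meet (here refl) (there (here refl))
      ... | x , x∈S∩T = ∈⇒∩-nonempty x∈S∩T x∈S∩T
      meet′ (here refl)          (there B∈ℬ) = meets-∩ B∈ℬ
      meet′ {S₁ = B} (there B∈ℬ) (here refl) = subst Nonempty (∩-comm (S ∩ T) B) (meets-∩ B∈ℬ)
      meet′ (there A∈ℬ)          (there B∈ℬ) = meet (there (there A∈ℬ)) (there (there B∈ℬ))

    helly : All (InducesConnected G) (S ∷ ℬ) → PairwiseIntersecting (S ∷ ℬ) →
            ∃[ v ] All (v ∈_) (S ∷ ℬ)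
    helly {S = S} {ℬ = []} _ meet with meet (here refl) (here refl)
    ... | v , v∈S∩S = v , proj₁ (x∈p∩q⁻ S S v∈S∩S) ∷ []
    helly {S = S} {ℬ = T ∷ ℬ} conn@(S-conn ∷ T-conn ∷ ℬ-conn) meet
      with helly (∩-connected S-conn T-conn ∷ ℬ-conn) (pairwiseIntersecting-∩ conn meet)
    ... | v , v∈S∩T ∷ v∈ℬ = v , proj₁ (x∈p∩q⁻ S T v∈S∩T) ∷ proj₂ (x∈p∩q⁻ S T v∈S∩T) ∷ v∈ℬ

    tightBramble⇒commonVertex : IsTightBramble G (S ∷ ℬ) → ∃[ v ] All (v ∈_) (S ∷ ℬ)
    tightBramble⇒commonVertex (touch , members) = helly conn
      (λ A∈ B∈ → touching⇒intersecting (All.lookup conn A∈) (All.lookup conn B∈) (touch A∈ B∈))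
      where
      conn = All.map proj₁ members

    forest-order≤1 : IsTightBramble G ℬ → HasOrder ℬ j → j ≤ 1
    forest-order≤1 {ℬ = []} _ (_ , minimal) =
      ≤-trans (minimal ⊥ []) (≤-trans (≤-reflexive (∣⊥∣≡0 n)) z≤n)
    forest-order≤1 {ℬ = _ ∷ _} tight order with tightBramble⇒commonVertex tight
    ... | _ , v∈ℬ = commonVertex⇒order≤1 v∈ℬ order

  edge⇒tightBramble-of-order1 : Adj x y → ∃[ ℬ ] (IsTightBramble G ℬ × HasOrder ℬ 1)
  edge⇒tightBramble-of-order1 {x = x} {y = y} xy =
    E ∷ [] , ((λ { (here refl) (here refl) → inj₁ (∈⇒∩-nonempty x∈E x∈E) })
             , (edge-connected xy , ≤-reflexive (sym (edge-size xy))) ∷ [])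
           , ((⁅ x ⁆ , ∈⇒∩-nonempty (x∈⁅x⁆ x) x∈E ∷ [] , ∣⁅x⁆∣≡1 x)
             , λ { C ((_ , u∈C∩E) ∷ []) → x∈p⇒0<∣p∣ (proj₁ (x∈p∩q⁻ C E u∈C∩E)) })
    where
    E = ⁅ x ⁆ ∪ ⁅ y ⁆
    x∈E = x∈⁅x⁆∪⁅y⁆ x y

  cycle⇒tightBramble-of-order2 : {vs : List (Fin n)} → IsCycle G vs →
                                 ∃[ ℬ ] (IsTightBramble G ℬ × HasOrder ℬ 2)
  cycle⇒tightBramble-of-order2 {vs = _ ∷ []}     (s≤s () , _)
  cycle⇒tightBramble-of-order2 {vs = _ ∷ _ ∷ []} (s≤s (s≤s ()) , _)
  cycle⇒tightBramble-of-order2 {vs = v₁ ∷ v₂ ∷ v₃ ∷ vs}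
    (_ , (v₁∉ ∷ v₂∉ ∷ _) , (v₁v₂ ∷ linked) , _ , b , refl , last≡b , bv₁) =
    𝒞 , ((λ S₁∈ S₂∈ → inj₁ (meet S₁∈ S₂∈))
         , (edge-connected v₁v₂ , ≤-reflexive (sym (edge-size v₁v₂)))
         ∷ (linked⇒fromList-connected linked , x∈p∧y∈p∧x≢y⇒1<∣p∣ v₂∈M b∈M v₂≢b)
         ∷ (edge-connected bv₁ , ≤-reflexive (sym (edge-size bv₁)))
         ∷ [])
      , ((E₁ , cover , edge-size v₁v₂) , λ C → noCommonVertex⇒1<∣cover∣ noCommon)
    where
    E₁ = ⁅ v₁ ⁆ ∪ ⁅ v₂ ⁆
    M  = fromList (v₂ ∷ v₃ ∷ vs)
    E₃ = ⁅ b ⁆ ∪ ⁅ v₁ ⁆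
    𝒞  = E₁ ∷ M ∷ E₃ ∷ []
    v₂∈M : v₂ ∈ M
    v₂∈M = ∈fromList⁺ {xs = v₂ ∷ v₃ ∷ vs} (here refl)
    b∈M : b ∈ M
    b∈M = ∈fromList⁺ (there (last≡just⇒∈ (v₃ ∷ vs) last≡b))
    v₁∉M : v₁ ∉ M
    v₁∉M v₁∈M = All¬⇒¬Any v₁∉ (∈fromList⁻ _ v₁∈M)
    v₂≢b : v₂ ≢ b
    v₂≢b refl = All¬⇒¬Any v₂∉ (last≡just⇒∈ (v₃ ∷ vs) last≡b)
    meet : PairwiseIntersecting 𝒞
    meet = triangle⇒pairwiseIntersecting (y∈⁅x⁆∪⁅y⁆ v₁ v₂) v₂∈M b∈M (x∈⁅x⁆∪⁅y⁆ b v₁)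
                                         (y∈⁅x⁆∪⁅y⁆ b v₁) (x∈⁅x⁆∪⁅y⁆ v₁ v₂)
    cover : IsCover 𝒞 E₁
    cover = meet (here refl) (here refl) ∷ meet (here refl) (there (here refl))
          ∷ meet (here refl) (there (there (here refl))) ∷ []
    noCommon : ¬ (∃[ u ] All (u ∈_) 𝒞)
    noCommon (u , u∈E₁ ∷ u∈M ∷ u∈E₃ ∷ []) with ∈⁅x⁆∪⁅y⁆⇒≡⊎≡ u∈E₁ | ∈⁅x⁆∪⁅y⁆⇒≡⊎≡ u∈E₃
    ... | inj₁ refl | _          = v₁∉M u∈M
    ... | inj₂ refl | inj₁ v₂≡b  = v₂≢b v₂≡b
    ... | inj₂ refl | inj₂ v₂≡v₁ = Adj⇒≢ v₁v₂ (sym v₂≡v₁)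

  maxOrder1⇒acyclic : MaxTightBrambleOrder G 1 → Acyclic G
  maxOrder1⇒acyclic (_ , maximal) _ cycle with cycle⇒tightBramble-of-order2 cycle
  ... | ℬ , tight , order2 with maximal ℬ 2 tight order2
  ...   | s≤s ()

mainTheorem5 : {n : ℕ} (G : Graph n) → Connected G → HasEdge G →
    (MaxTightBrambleOrder G 1 ⇔ IsTree G)
mainTheorem5 G connected (_ , _ , xy) = mk⇔
  (λ maxOrder1 → connected , maxOrder1⇒acyclic G maxOrder1)
  (λ (_ , acyclic) → edge⇒tightBramble-of-order1 G xy , λ _ _ → forest-order≤1 G acyclic)
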